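{- Let $\varphi_1,\varphi_2,\psi_1,\psi_2$ be formulas and let $\chi_1[\cdot]$, $\chi_2[\cdot]$ be formulas with placeholders. Then (a) $\varphi_1\,\mathbf{W}\,\chi_2[\psi_1\,\mathbf{U}\,\psi_2] \equiv (\varphi_1\,\mathbf{U}\,\chi_2[\psi_1\,\mathbf{U}\,\psi_2]) \vee \mathbf{G}\varphi_1$, and (b) $\chi_1[\psi_1\,\mathbf{U}\,\psi_2]\,\mathbf{W}\,\varphi_2 \equiv \big(\mathbf{GF}\psi_2 \wedge \chi_1[\psi_1\,\mathbf{W}\,\psi_2]\,\mathbf{W}\,\varphi_2\big) \vee \chi_1[\psi_1\,\mathbf{U}\,\psi_2]\,\mathbf{U}\,\big(\varphi_2 \vee \mathbf{G}\chi_1[\mathbf{ff}]\big)$.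
   Context: Fix a finite set $Ap$ of atomic propositions. Formulas are generated by $\varphi ::= \mathbf{tt} \mid \mathbf{ff} \mid a \mid \neg a \mid \varphi\wedge\varphi \mid \varphi\vee\varphi \mid \mathbf{X}\varphi \mid \varphi\,\mathbf{U}\,\varphi \mid \varphi\,\mathbf{W}\,\varphi \mid \mathbf{GF}\varphi \mid \mathbf{FG}\varphi$ with $a\in Ap$, interpreted over infinite words $w$ over $2^{Ap}$ ($w_k$ the suffix from position $k$): $w\models a$ iff $a\in w[0]$; $w\models\neg a$ iff $a\notin w[0]$; Boolean connectives as usual; $w\models\mathbf{X}\varphi$ iff $w_1\models\varphi$; $w\models\varphi\,\mathbf{U}\,\psi$ iff there is $k$ with $w_k\models\psi$ and $w_j\models\varphi$ for all $j<k$; $w\models\varphi\,\mathbf{W}\,\psi$ iff $w_k\models\varphi$ for all $k$ or $w\models\varphi\,\mathbf{U}\,\psi$; $w\models\mathbf{GF}\varphi$ iff $w_k\models\varphi$ for infinitely many $k$; $w\models\mathbf{FG}\varphi$ iff there is $n$ with $w_k\models\varphi$ for all $k\ge n$. $\mathbf{G}\varphi$ abbreviates a formula satisfied by $w$ iff $w_k\models\varphi$ for all $k$ (e.g. $\varphi\,\mathbf{W}\,\mathbf{ff}$). $\equiv$ means satisfied by exactly the same words. A formula with placeholders $\chi[\cdot]$ is a formula over $Ap\cup\{\square\}$ for a fresh atomic proposition $\square$ that occurs at least once and only positively (never as $\neg\square$); $\chi[\psi]$ denotes the result of substituting $\psi$ for every occurrence of $\square$ in $\chi$. -}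

module Defs where

open import Data.Nat using (ℕ; _+_; _<_; _≤_)
open import Data.Fin using (Fin)
open import Data.Fin.Subset using (Subset; _∈_; _∉_)
open import Data.Maybe using (Maybe; just; nothing)
open import Data.Product using (Σ; _×_)
open import Data.Sum using (_⊎_)
open import Data.Unit using (⊤)
open import Data.Empty using (⊥)
open import Function.Bundles using (_⇔_)

infixr 6 _∧_
infixr 5 _∨_
infixr 7 _U_ _W_
data Formula (A : Set) : Set where
  tt ff : Formula A
  atom  : A → Formula A
  neg   : A → Formula A
  _∧_ _∨_ : Formula A → Formula A → Formula A
  X     : Formula A → Formula A
  _U_ _W_ : Formula A → Formula A → Formula A
  GF FG : Formula A → Formula A

G : {A : Set} → Formula A → Formula A
G φ = φ W ff

-- Ap = Fin n (a finite set); letters are elements of 2^Ap = Subset n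
Word : ℕ → Set
Word n = ℕ → Subset n

suffix : {n : ℕ} → ℕ → Word n → Word n
suffix k w = λ i → w (k + i)

infix 4 _⊨_
_⊨_ : {n : ℕ} → Word n → Formula (Fin n) → Set
w ⊨ tt = ⊤
w ⊨ ff = ⊥
w ⊨ atom a = a ∈ w 0
w ⊨ neg a = a ∉ w 0
w ⊨ φ ∧ ψ = (w ⊨ φ) × (w ⊨ ψ)
w ⊨ φ ∨ ψ = (w ⊨ φ) ⊎ (w ⊨ ψ)
w ⊨ X φ = suffix 1 w ⊨ φ
w ⊨ φ U ψ = Σ ℕ λ k → (suffix k w ⊨ ψ) × ((j : ℕ) → j < k → suffix j w ⊨ φ)
w ⊨ φ W ψ = ((k : ℕ) → suffix k w ⊨ φ)
           ⊎ (Σ ℕ λ k → (suffix k w ⊨ ψ) × ((j : ℕ) → j < k → suffix j w ⊨ φ))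
w ⊨ GF φ = (m : ℕ) → Σ ℕ λ k → (m ≤ k) × (suffix k w ⊨ φ)
w ⊨ FG φ = Σ ℕ λ m → (k : ℕ) → m ≤ k → suffix k w ⊨ φ

infix 3 _≡ₗ_
_≡ₗ_ : {n : ℕ} → Formula (Fin n) → Formula (Fin n) → Set
_≡ₗ_ {n} φ ψ = (w : Word n) → (w ⊨ φ) ⇔ (w ⊨ ψ)

-- formulas with placeholders: formulas over Ap ∪ {□}, with □ = nothing
PFormula : ℕ → Set
PFormula n = Formula (Maybe (Fin n))

Positive : {A : Set} → Formula (Maybe A) → Set
Positive tt = ⊤
Positive ff = ⊤
Positive (atom _) = ⊤
Positive (neg (just _)) = ⊤
Positive (neg nothing) = ⊥
Positive (φ ∧ ψ) = Positive φ × Positive ψ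
Positive (φ ∨ ψ) = Positive φ × Positive ψ
Positive (X φ) = Positive φ
Positive (φ U ψ) = Positive φ × Positive ψ
Positive (φ W ψ) = Positive φ × Positive ψ
Positive (GF φ) = Positive φ
Positive (FG φ) = Positive φ

Occurs : {A : Set} → Formula (Maybe A) → Set
Occurs tt = ⊥
Occurs ff = ⊥
Occurs (atom (just _)) = ⊥
Occurs (atom nothing) = ⊤
Occurs (neg _) = ⊥
Occurs (φ ∧ ψ) = Occurs φ ⊎ Occurs ψ
Occurs (φ ∨ ψ) = Occurs φ ⊎ Occurs ψ
Occurs (X φ) = Occurs φ
Occurs (φ U ψ) = Occurs φ ⊎ Occurs ψ
Occurs (φ W ψ) = Occurs φ ⊎ Occurs ψ
Occurs (GF φ) = Occurs φ
Occurs (FG φ) = Occurs φ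

IsPlaceholderFormula : {A : Set} → Formula (Maybe A) → Set
IsPlaceholderFormula χ = Occurs χ × Positive χ

_[_] : {A : Set} → Formula (Maybe A) → Formula A → Formula A
tt [ θ ] = tt
ff [ θ ] = ff
atom (just a) [ θ ] = atom a
atom nothing [ θ ] = θ
neg (just a) [ θ ] = neg a
neg nothing [ θ ] = ff   -- never used for placeholder formulas (Positive excludes ¬□)
(φ ∧ ψ) [ θ ] = φ [ θ ] ∧ ψ [ θ ]
(φ ∨ ψ) [ θ ] = φ [ θ ] ∨ ψ [ θ ]
X φ [ θ ] = X (φ [ θ ])
(φ U ψ) [ θ ] = φ [ θ ] U ψ [ θ ]
(φ W ψ) [ θ ] = φ [ θ ] W ψ [ θ ]
GF φ [ θ ] = GF (φ [ θ ])
FG φ [ θ ] = FG (φ [ θ ])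

-- For (b), split classically on whether ψ₂ holds infinitely often. If it does, then on
-- every suffix ψ₁ U ψ₂ and ψ₁ W ψ₂ agree, so by positivity of □ the two instances of χ₁
-- agree on every suffix and both sides reduce to χ₁[ψ₁ W ψ₂] W φ₂. If it does not, then
-- from some position m on ψ₂ never holds, where ψ₁ U ψ₂ agrees with ff; so a run of
-- χ₁[ψ₁ U ψ₂] that never reaches φ₂ satisfies G χ₁[ff] from m on. Conversely, χ₁[ff]
-- implies χ₁[ψ₁ U ψ₂] by positivity, which closes the until on the right.
module Submission where

open import Defs
open import Data.Nat using (ℕ; _+_; _∸_; _<_; _≤_; _<?_)
open import Data.Nat.Properties using (+-assoc; m≤m+n; ≮⇒≥; m+[n∸m]≡n; m+n∸m≡n; ∸-monoˡ-≤; ≤-trans)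
open import Data.Fin using (Fin)
open import Data.Fin.Subset using (_∈_)
open import Data.Maybe using (just; nothing)
open import Data.Product using (_×_; _,_; Σ)
open import Data.Sum using (inj₁; inj₂)
open import Data.Unit using (⊤; tt)
open import Function.Bundles using (mk⇔)
open import Relation.Nullary using (yes; no; ¬_)
open import Relation.Binary.PropositionalEquality using (_≡_; sym; cong; subst)
open import Level using (0ℓ)
open import Axiom.ExcludedMiddle using (ExcludedMiddle)
open import Axiom.DoubleNegationElimination using (em⇒dne)

module _ {n : ℕ} where

  ⊨-cong : ∀ φ {v v′ : Word n} → (∀ i → v i ≡ v′ i) → v ⊨ φ → v′ ⊨ φ
  ⊨-cong Formula.tt eq h = h
  ⊨-cong ff eq h = h
  ⊨-cong (atom a) eq h = subst (a ∈_) (eq 0) h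
  ⊨-cong (neg a) eq h a∈ = h (subst (a ∈_) (sym (eq 0)) a∈)
  ⊨-cong (φ ∧ ψ) eq (hφ , hψ) = ⊨-cong φ eq hφ , ⊨-cong ψ eq hψ
  ⊨-cong (φ ∨ ψ) eq (inj₁ hφ) = inj₁ (⊨-cong φ eq hφ)
  ⊨-cong (φ ∨ ψ) eq (inj₂ hψ) = inj₂ (⊨-cong ψ eq hψ)
  ⊨-cong (X φ) eq h = ⊨-cong φ (λ i → eq (1 + i)) h
  ⊨-cong (φ U ψ) eq (k , hψ , hφ) =
    k , ⊨-cong ψ (λ i → eq (k + i)) hψ , λ j j<k → ⊨-cong φ (λ i → eq (j + i)) (hφ j j<k)
  ⊨-cong (φ W ψ) eq (inj₁ hφ) = inj₁ (λ k → ⊨-cong φ (λ i → eq (k + i)) (hφ k))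
  ⊨-cong (φ W ψ) eq (inj₂ (k , hψ , hφ)) =
    inj₂ (k , ⊨-cong ψ (λ i → eq (k + i)) hψ , λ j j<k → ⊨-cong φ (λ i → eq (j + i)) (hφ j j<k))
  ⊨-cong (GF φ) eq h m with h m
  ... | k , m≤k , hφ = k , m≤k , ⊨-cong φ (λ i → eq (k + i)) hφ
  ⊨-cong (FG φ) eq (m , h) = m , λ k m≤k → ⊨-cong φ (λ i → eq (k + i)) (h k m≤k)

  suffix-suffix : ∀ k j (w : Word n) i → suffix j (suffix k w) i ≡ suffix (k + j) w i
  suffix-suffix k j w i = cong w (sym (+-assoc k j i))

  ⊨-suffix-+ : ∀ φ k j (w : Word n) → suffix j (suffix k w) ⊨ φ → suffix (k + j) w ⊨ φ
  ⊨-suffix-+ φ k j w = ⊨-cong φ (suffix-suffix k j w)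

  ⊨-+-suffix : ∀ φ k j (w : Word n) → suffix (k + j) w ⊨ φ → suffix j (suffix k w) ⊨ φ
  ⊨-+-suffix φ k j w = ⊨-cong φ (λ i → sym (suffix-suffix k j w i))

  G-elim : ∀ φ (w : Word n) → w ⊨ G φ → ∀ k → suffix k w ⊨ φ
  G-elim φ w (inj₁ always) = always
  G-elim φ w (inj₂ (_ , () , _))

  always-from-prefix-and-suffix : ∀ φ k (w : Word n) →
    (∀ j → j < k → suffix j w ⊨ φ) → (∀ i → suffix i (suffix k w) ⊨ φ) →
    ∀ j → suffix j w ⊨ φ
  always-from-prefix-and-suffix φ k w before after j with j <? k
  ... | yes j<k = before j j<k
  ... | no j≮k = subst (λ x → suffix x w ⊨ φ) (m+[n∸m]≡n (≮⇒≥ j≮k))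
                       (⊨-suffix-+ φ k (j ∸ k) w (after (j ∸ k)))

  W-monoˡ : ∀ θ θ′ φ (w : Word n) → (∀ k → suffix k w ⊨ θ → suffix k w ⊨ θ′) →
            w ⊨ θ W φ → w ⊨ θ′ W φ
  W-monoˡ θ θ′ φ w θ⇒θ′ (inj₁ always) = inj₁ (λ k → θ⇒θ′ k (always k))
  W-monoˡ θ θ′ φ w θ⇒θ′ (inj₂ (k , hφ , before)) = inj₂ (k , hφ , λ j j<k → θ⇒θ′ j (before j j<k))

  W≡ₗU∨G : ∀ φ ψ → φ W ψ ≡ₗ (φ U ψ) ∨ G φ
  W≡ₗU∨G φ ψ w = mk⇔ to from
    where
      to : w ⊨ φ W ψ → w ⊨ (φ U ψ) ∨ G φ
      to (inj₁ always) = inj₂ (inj₁ always)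
      to (inj₂ until) = inj₁ until
      from : w ⊨ (φ U ψ) ∨ G φ → w ⊨ φ W ψ
      from (inj₁ until) = inj₂ until
      from (inj₂ always) = inj₁ (G-elim φ w always)

  SuffixClosed : (Word n → Set) → Set
  SuffixClosed Q = ∀ k w → Q w → Q (suffix k w)

  module _ {Q : Word n → Set} (Q-suffix : SuffixClosed Q) {θ θ′ : Formula (Fin n)}
           (θ⇒θ′ : ∀ v → Q v → v ⊨ θ → v ⊨ θ′) where

    []-mono-on : ∀ χ → Positive χ → ∀ v → Q v → v ⊨ χ [ θ ] → v ⊨ χ [ θ′ ]
    []-mono-on Formula.tt _ v q h = h
    []-mono-on ff _ v q h = h
    []-mono-on (atom (just a)) _ v q h = h
    []-mono-on (atom nothing) _ v q h = θ⇒θ′ v q h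
    []-mono-on (neg (just a)) _ v q h = h
    []-mono-on (φ ∧ ψ) (pφ , pψ) v q (hφ , hψ) = []-mono-on φ pφ v q hφ , []-mono-on ψ pψ v q hψ
    []-mono-on (φ ∨ ψ) (pφ , pψ) v q (inj₁ hφ) = inj₁ ([]-mono-on φ pφ v q hφ)
    []-mono-on (φ ∨ ψ) (pφ , pψ) v q (inj₂ hψ) = inj₂ ([]-mono-on ψ pψ v q hψ)
    []-mono-on (X φ) pφ v q h = []-mono-on φ pφ _ (Q-suffix 1 v q) h
    []-mono-on (φ U ψ) (pφ , pψ) v q (k , hψ , hφ) =
      k , []-mono-on ψ pψ _ (Q-suffix k v q) hψ ,
      λ j j<k → []-mono-on φ pφ _ (Q-suffix j v q) (hφ j j<k)
    []-mono-on (φ W ψ) (pφ , pψ) v q (inj₁ always) =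
      inj₁ (λ k → []-mono-on φ pφ _ (Q-suffix k v q) (always k))
    []-mono-on (φ W ψ) (pφ , pψ) v q (inj₂ (k , hψ , hφ)) =
      inj₂ (k , []-mono-on ψ pψ _ (Q-suffix k v q) hψ ,
            λ j j<k → []-mono-on φ pφ _ (Q-suffix j v q) (hφ j j<k))
    []-mono-on (GF φ) pφ v q h m with h m
    ... | k , m≤k , hφ = k , m≤k , []-mono-on φ pφ _ (Q-suffix k v q) hφ
    []-mono-on (FG φ) pφ v q (m , h) = m , λ k m≤k → []-mono-on φ pφ _ (Q-suffix k v q) (h k m≤k)

  []-mono : ∀ {θ θ′} → (∀ v → v ⊨ θ → v ⊨ θ′) →
            ∀ χ → Positive χ → ∀ v → v ⊨ χ [ θ ] → v ⊨ χ [ θ′ ]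
  []-mono θ⇒θ′ χ pos v = []-mono-on {Q = λ _ → ⊤} (λ _ _ _ → tt) (λ v _ → θ⇒θ′ v) χ pos v tt

  GF-suffixClosed : ∀ ψ → SuffixClosed (_⊨ GF ψ)
  GF-suffixClosed ψ k w gf m with gf (k + m)
  ... | k′ , k+m≤k′ , hψ = k′ ∸ k , m≤k′∸k , ⊨-+-suffix ψ k (k′ ∸ k) w hψ′
    where
      m≤k′∸k : m ≤ k′ ∸ k
      m≤k′∸k = subst (_≤ k′ ∸ k) (m+n∸m≡n k m) (∸-monoˡ-≤ k k+m≤k′)
      hψ′ : suffix (k + (k′ ∸ k)) w ⊨ ψ
      hψ′ = subst (λ x → suffix x w ⊨ ψ) (sym (m+[n∸m]≡n (≤-trans (m≤m+n k m) k+m≤k′))) hψ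

  Never : Formula (Fin n) → Word n → Set
  Never ψ w = ∀ k → ¬ (suffix k w ⊨ ψ)

  Never-suffixClosed : ∀ ψ → SuffixClosed (Never ψ)
  Never-suffixClosed ψ k w never j hψ = never (k + j) (⊨-suffix-+ ψ k j w hψ)

  ¬GF⇒eventually-Never : ExcludedMiddle 0ℓ → ∀ ψ (w : Word n) →
    ¬ (w ⊨ GF ψ) → Σ ℕ λ m → Never ψ (suffix m w)
  ¬GF⇒eventually-Never em ψ w ¬gf = dne λ ¬eventually →
    ¬gf λ m → dne (λ ¬later → ¬eventually (m , λ j hψ →
      ¬later (m + j , m≤m+n m j , ⊨-suffix-+ ψ m j w hψ)))
    where dne = em⇒dne em

  W⇒U-if-GF : ∀ ψ₁ ψ₂ (w : Word n) → w ⊨ GF ψ₂ → w ⊨ ψ₁ W ψ₂ → w ⊨ ψ₁ U ψ₂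
  W⇒U-if-GF ψ₁ ψ₂ w gf (inj₁ always) with gf 0
  ... | k , _ , hψ₂ = k , hψ₂ , λ j _ → always j
  W⇒U-if-GF ψ₁ ψ₂ w gf (inj₂ until) = until

  ¬U-if-Never : ∀ ψ₁ ψ₂ (w : Word n) → Never ψ₂ w → ¬ (w ⊨ ψ₁ U ψ₂)
  ¬U-if-Never ψ₁ ψ₂ w never (k , hψ₂ , _) = never k hψ₂

  U[]⇒W[] : ∀ ψ₁ ψ₂ χ → Positive χ → ∀ w → w ⊨ χ [ ψ₁ U ψ₂ ] → w ⊨ χ [ ψ₁ W ψ₂ ]
  U[]⇒W[] ψ₁ ψ₂ = []-mono (λ _ → inj₂)

  W[]⇒U[]-if-GF : ∀ ψ₁ ψ₂ χ → Positive χ → ∀ w → w ⊨ GF ψ₂ →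
    w ⊨ χ [ ψ₁ W ψ₂ ] → w ⊨ χ [ ψ₁ U ψ₂ ]
  W[]⇒U[]-if-GF ψ₁ ψ₂ = []-mono-on (GF-suffixClosed ψ₂) (W⇒U-if-GF ψ₁ ψ₂)

  U[]⇒ff[]-if-Never : ∀ ψ₁ ψ₂ χ → Positive χ → ∀ w → Never ψ₂ w →
    w ⊨ χ [ ψ₁ U ψ₂ ] → w ⊨ χ [ ff ]
  U[]⇒ff[]-if-Never ψ₁ ψ₂ =
    []-mono-on (Never-suffixClosed ψ₂) (¬U-if-Never ψ₁ ψ₂)

  ff[]⇒[] : ∀ θ χ → Positive χ → ∀ w → w ⊨ χ [ ff ] → w ⊨ χ [ θ ]
  ff[]⇒[] θ = []-mono (λ _ ())

  module _ (em : ExcludedMiddle 0ℓ) (ψ₁ ψ₂ φ₂ : Formula (Fin n)) (χ : PFormula n)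
           (pos : Positive χ) where

    U[]W⇒ : ∀ w → w ⊨ χ [ ψ₁ U ψ₂ ] W φ₂ →
      w ⊨ (GF ψ₂ ∧ χ [ ψ₁ W ψ₂ ] W φ₂) ∨ χ [ ψ₁ U ψ₂ ] U (φ₂ ∨ G (χ [ ff ]))
    U[]W⇒ w h with em {w ⊨ GF ψ₂}
    ... | yes gf =
      inj₁ (gf , W-monoˡ (χ [ ψ₁ U ψ₂ ]) (χ [ ψ₁ W ψ₂ ]) φ₂ w
                   (λ k → U[]⇒W[] ψ₁ ψ₂ χ pos (suffix k w)) h)
    U[]W⇒ w (inj₂ (k , hφ₂ , before)) | no _ = inj₂ (k , inj₁ hφ₂ , before)
    U[]W⇒ w (inj₁ always) | no ¬gf with ¬GF⇒eventually-Never em ψ₂ w ¬gf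
    ... | m , never = inj₂ (m , inj₂ (inj₁ always-ff) , λ j _ → always j)
      where
        always-ff : ∀ i → suffix i (suffix m w) ⊨ χ [ ff ]
        always-ff i =
          U[]⇒ff[]-if-Never ψ₁ ψ₂ χ pos _ (Never-suffixClosed ψ₂ i (suffix m w) never)
            (⊨-+-suffix (χ [ ψ₁ U ψ₂ ]) m i w (always (m + i)))

    ⇒U[]W : ∀ w → w ⊨ (GF ψ₂ ∧ χ [ ψ₁ W ψ₂ ] W φ₂) ∨ χ [ ψ₁ U ψ₂ ] U (φ₂ ∨ G (χ [ ff ])) →
      w ⊨ χ [ ψ₁ U ψ₂ ] W φ₂
    ⇒U[]W w (inj₁ (gf , h)) =
      W-monoˡ (χ [ ψ₁ W ψ₂ ]) (χ [ ψ₁ U ψ₂ ]) φ₂ w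
        (λ k → W[]⇒U[]-if-GF ψ₁ ψ₂ χ pos (suffix k w) (GF-suffixClosed ψ₂ k w gf)) h
    ⇒U[]W w (inj₂ (k , inj₁ hφ₂ , before)) = inj₂ (k , hφ₂ , before)
    ⇒U[]W w (inj₂ (k , inj₂ always-ff , before)) =
      inj₁ (always-from-prefix-and-suffix (χ [ ψ₁ U ψ₂ ]) k w before
              (λ i → ff[]⇒[] (ψ₁ U ψ₂) χ pos _ (G-elim (χ [ ff ]) (suffix k w) always-ff i)))

    U[]W≡ₗ : χ [ ψ₁ U ψ₂ ] W φ₂ ≡ₗ
             (GF ψ₂ ∧ χ [ ψ₁ W ψ₂ ] W φ₂) ∨ χ [ ψ₁ U ψ₂ ] U (φ₂ ∨ G (χ [ ff ]))
    U[]W≡ₗ w = mk⇔ (U[]W⇒ w) (⇒U[]W w)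

lemma1 : ExcludedMiddle 0ℓ →
    (n : ℕ) (φ₁ φ₂ ψ₁ ψ₂ : Formula (Fin n)) (χ₁ χ₂ : PFormula n) →
    IsPlaceholderFormula χ₁ → IsPlaceholderFormula χ₂ →
    ((φ₁ W (χ₂ [ ψ₁ U ψ₂ ])) ≡ₗ ((φ₁ U (χ₂ [ ψ₁ U ψ₂ ])) ∨ G φ₁))
    × (((χ₁ [ ψ₁ U ψ₂ ]) W φ₂)
        ≡ₗ ((GF ψ₂ ∧ ((χ₁ [ ψ₁ W ψ₂ ]) W φ₂)) ∨ ((χ₁ [ ψ₁ U ψ₂ ]) U (φ₂ ∨ G (χ₁ [ ff ])))))
lemma1 em n φ₁ φ₂ ψ₁ ψ₂ χ₁ χ₂ (_ , pos₁) _ =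
  W≡ₗU∨G φ₁ (χ₂ [ ψ₁ U ψ₂ ]) , U[]W≡ₗ em ψ₁ ψ₂ φ₂ χ₁ pos₁
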